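{- Suppose the graph with terminals $(G,a,b)$ has a GSP decomposition $T$ of complexity $k$. Then $G$ contains at least $k$ pairwise internally vertex-disjoint bipaths, each with endpoints $\{a,b\}$.
   Context: A bipath is the union of two edge-disjoint paths $P_1,P_2$ with the same two endpoints, sharing at least three vertices (including the endpoints), the shared vertices appearing in the same order along both; its endpoints are the common endpoints. A graph with terminals is $(G,u,v)$ with $u\ne v\in V(G)$. GSP graphs: smallest class of graphs with terminals containing each single edge with its endpoints as terminals and closed under $(G,u,v)\circ_s(H,v,w)=(G\cup H,u,w)$ if $V(G)\cap V(H)=\{v\}$; $(G,u,v)\circ_p(H,u,v)=(G\cup H,u,v)$ if $V(G)\cap V(H)=\{u,v\}$; $(G,u,v)\circ_b(H,u,w)=(G\cup H,u,v)$ if $V(G)\cap V(H)=\{u\}$; $(G,u,v)\circ_{b'}(H,v,w)=(G\cup H,u,v)$ if $V(G)\cap V(H)=\{v\}$. A GSP decomposition of $\mathbf G$ is a rooted binary tree of GSP graphs with root $\mathbf G$: a single node if $\mathbf G$ is a single edge, otherwise decompositions of $\mathbf H,\mathbf K$ joined to the root where $\mathbf G=\mathbf H\circ\mathbf K$. A graph with terminals is bridged if some edge lies on every path between its terminals. Complexity $c(T)$: if the root operation is $\circ_p$, the sum of the children's complexities; if $\circ_b$ or $\circ_{b'}$, the complexity of the child sharing its terminals with $\mathbf G$; otherwise (single edge or $\circ_s$) $0$ if $\mathbf G$ is bridged and $1$ if not. -}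

module Defs where

open import Data.Nat using (ℕ; _≟_; _≥_)
open import Data.Fin using (Fin)
open import Data.Product using (_×_; _,_; proj₁; proj₂; Σ; ∃)
open import Data.Sum using (_⊎_)
open import Data.List using (List; []; _∷_; _++_; length; lookup; filter)
open import Data.List.Relation.Unary.Any using (Any)
open import Data.List.Relation.Unary.Unique.Propositional using (Unique)
open import Data.List.Membership.Propositional using (_∈_)
open import Data.List.Membership.DecPropositional _≟_ using (_∈?_)
open import Relation.Binary.PropositionalEquality using (_≡_; _≢_)
open import Relation.Nullary using (¬_)
open import Function.Bundles using (_⇔_)

-- A (multi)graph: a list of edges; each edge is the pair of its endpoints.
-- Edges are identified by their position (index) in the list, so parallel
-- edges are distinct objects.
Edge : Set
Edge = ℕ × ℕ

Graph : Set
Graph = List Edge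

-- x is a vertex of G (vertex set = endpoints of edges; GSP graphs have no
-- isolated vertices).
_∈V_ : ℕ → Graph → Set
x ∈V G = Any (λ e → x ≡ proj₁ e ⊎ x ≡ proj₂ e) G

Joins : Edge → ℕ → ℕ → Set
Joins e x y = (x ≡ proj₁ e × y ≡ proj₂ e) ⊎ (x ≡ proj₂ e × y ≡ proj₁ e)

EdgeId : Graph → Set
EdgeId G = Fin (length G)

data Walk (G : Graph) : ℕ → ℕ → Set where
  []   : ∀ {x} → Walk G x x
  step : ∀ {x y z} (e : EdgeId G) → Joins (lookup G e) x y → Walk G y z → Walk G x z

verts : ∀ {G x y} → Walk G x y → List ℕ
verts {x = x} []          = x ∷ []
verts {x = x} (step e _ w) = x ∷ verts w

edges : ∀ {G x y} → Walk G x y → List (EdgeId G)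
edges []           = []
edges (step e _ w) = e ∷ edges w

IsPath : ∀ {G x y} → Walk G x y → Set
IsPath w = Unique (verts w)

record Path (G : Graph) (x y : ℕ) : Set where
  constructor mkPath
  field
    walk   : Walk G x y
    isPath : IsPath walk
open Path public

Bridged : Graph → ℕ → ℕ → Set
Bridged G u v = Σ (EdgeId G) λ e → (p : Path G u v) → e ∈ edges (walk p)

-- GSP graphs with terminals; an inhabitant is a GSP decomposition tree.
-- Union of graphs = concatenation of edge lists (edges of the two parts are
-- distinct objects).
data GSP : Graph → ℕ → ℕ → Set where
  single : ∀ u v → u ≢ v → GSP ((u , v) ∷ []) u v
  ser  : ∀ {G H u v w} → GSP G u v → GSP H v w →
         (∀ x → (x ∈V G × x ∈V H) ⇔ (x ≡ v)) → GSP (G ++ H) u w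
  par  : ∀ {G H u v} → GSP G u v → GSP H u v →
         (∀ x → (x ∈V G × x ∈V H) ⇔ (x ≡ u ⊎ x ≡ v)) → GSP (G ++ H) u v
  brL  : ∀ {G H u v w} → GSP G u v → GSP H u w →
         (∀ x → (x ∈V G × x ∈V H) ⇔ (x ≡ u)) → GSP (G ++ H) u v
  brR  : ∀ {G H u v w} → GSP G u v → GSP H v w →
         (∀ x → (x ∈V G × x ∈V H) ⇔ (x ≡ v)) → GSP (G ++ H) u v

data Complexity : ∀ {G u v} → GSP G u v → ℕ → Set where
  single-br  : ∀ {u v p} → Bridged ((u , v) ∷ []) u v → Complexity (single u v p) 0
  single-nbr : ∀ {u v p} → ¬ Bridged ((u , v) ∷ []) u v → Complexity (single u v p) 1
  ser-br  : ∀ {G H u v w} {t₁ : GSP G u v} {t₂ : GSP H v w} {p} →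
            Bridged (G ++ H) u w → Complexity (ser t₁ t₂ p) 0
  ser-nbr : ∀ {G H u v w} {t₁ : GSP G u v} {t₂ : GSP H v w} {p} →
            ¬ Bridged (G ++ H) u w → Complexity (ser t₁ t₂ p) 1
  par-c   : ∀ {G H u v} {t₁ : GSP G u v} {t₂ : GSP H u v} {p} {k₁ k₂} →
            Complexity t₁ k₁ → Complexity t₂ k₂ → Complexity (par t₁ t₂ p) (k₁ Data.Nat.+ k₂)
  brL-c   : ∀ {G H u v w} {t₁ : GSP G u v} {t₂ : GSP H u w} {p} {k} →
            Complexity t₁ k → Complexity (brL t₁ t₂ p) k
  brR-c   : ∀ {G H u v w} {t₁ : GSP G u v} {t₂ : GSP H v w} {p} {k} →
            Complexity t₁ k → Complexity (brR t₁ t₂ p) k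

-- Bipath in G with endpoints a, b: two edge-disjoint paths a → b, sharing at
-- least three vertices, the shared vertices in the same order along both.
record Bipath (G : Graph) (a b : ℕ) : Set where
  constructor mkBipath
  field
    P₁ P₂ : Path G a b
    edge-disjoint : ∀ e → e ∈ edges (walk P₁) → ¬ (e ∈ edges (walk P₂))
    same-order :
      filter (_∈? verts (walk P₂)) (verts (walk P₁))
        ≡ filter (_∈? verts (walk P₁)) (verts (walk P₂))
    three-shared : length (filter (_∈? verts (walk P₂)) (verts (walk P₁))) ≥ 3
open Bipath public

_∈B_ : ∀ {G a b} → ℕ → Bipath G a b → Set
x ∈B B = x ∈ verts (walk (P₁ B)) ⊎ x ∈ verts (walk (P₂ B))

InternallyDisjoint : ∀ {G a b} → Bipath G a b → Bipath G a b → Set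
InternallyDisjoint {a = a} {b = b} B C = ∀ x → x ∈B B → x ∈B C → x ≡ a ⊎ x ≡ b

{-# OPTIONS --safe #-}
-- Every GSP graph with terminals (G,u,v) either has a cut, i.e. an edge e and a
-- two-colouring of the vertices separating u from v in which every edge other
-- than e is monochromatic (so e is a bridge), or it contains two edge-disjoint
-- u–v paths whose common vertices appear in the same order along both.  This
-- dichotomy is preserved by the four operations, and a parallel composition is
-- always of the second kind.  A series composition of complexity 1 is not
-- bridged, so both of its factors are of the second kind, and concatenating the
-- two pairs of paths at the middle terminal yields a bipath.  Parallel
-- composition adds complexities, and the bipaths of its two parts are
-- internally disjoint because the parts share only the terminals; the branch
-- operations merely add edges.
module Submission where

open import Defs
open import Data.Bool using (Bool; true; false; if_then_else_)
open import Data.Empty using (⊥-elim)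
open import Data.Fin using (Fin; zero; suc; splitAt) renaming (_≟_ to _≟ᶠ_)
open import Data.Fin.Properties using (suc-injective; splitAt⁻¹-↑ˡ; splitAt⁻¹-↑ʳ)
open import Data.List using (List; []; _∷_; _++_; _∷ʳ_; length; lookup; filter; map)
open import Data.Nat using (ℕ; zero; suc; _≟_; _≤_; _+_; s≤s; z≤n)
open import Data.List.Membership.DecPropositional _≟_ using (_∈?_)
open import Data.List.Membership.Propositional using (_∈_; _∉_; lose)
open import Data.List.Membership.Propositional.Properties
  using (∈-lookup; ∈-map⁻; ∈-++⁻; ∈-++⁺ˡ; ∈-++⁺ʳ)
open import Data.List.Properties
  using (filter-++; filter-accept; filter-none; ∷ʳ-injectiveˡ; ++-assoc; length-++; length-++-≤ʳ)
open import Data.List.Relation.Binary.Disjoint.Propositional using (Disjoint)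
open import Data.List.Relation.Unary.All as All using (All; []; _∷_)
open import Data.List.Relation.Unary.Any using (here; there; any?)
open import Data.List.Relation.Unary.Any.Properties using (++⁺ˡ; ++⁺ʳ)
open import Data.List.Relation.Unary.Unique.Propositional using (Unique)
open import Data.List.Relation.Unary.AllPairs using ([]; _∷_)
import Data.List.Relation.Unary.Unique.Propositional.Properties as Unique
open import Data.Nat.Properties using (≤-trans; +-monoˡ-≤)
open import Data.Product using (Σ; _×_; _,_; proj₁; proj₂)
open import Data.Sum as Sum using (_⊎_; inj₁; inj₂)
import Data.Vec.Functional as Vector
open import Function.Base using (_∘_)
open import Function.Bundles using (_⇔_; mk⇔; Equivalence)
open import Relation.Binary.PropositionalEquality
  using (_≡_; _≢_; refl; sym; trans; cong; cong₂; subst; subst₂; module ≡-Reasoning)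
open import Relation.Nullary using (Dec; yes; no; does)
open import Relation.Nullary.Decidable using (_⊎-dec_; dec-true; dec-false)

-- Edge embeddings

injectˡ : ∀ G H → EdgeId G → EdgeId (G ++ H)
injectˡ (_ ∷ G) H zero    = zero
injectˡ (_ ∷ G) H (suc i) = suc (injectˡ G H i)

injectʳ : ∀ G H → EdgeId H → EdgeId (G ++ H)
injectʳ []      H j = j
injectʳ (_ ∷ G) H j = suc (injectʳ G H j)

lookup-injectˡ : ∀ G H i → lookup (G ++ H) (injectˡ G H i) ≡ lookup G i
lookup-injectˡ (_ ∷ G) H zero    = refl
lookup-injectˡ (_ ∷ G) H (suc i) = lookup-injectˡ G H i

lookup-injectʳ : ∀ G H j → lookup (G ++ H) (injectʳ G H j) ≡ lookup H j
lookup-injectʳ []      H j = refl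
lookup-injectʳ (_ ∷ G) H j = lookup-injectʳ G H j

injectˡ-injective : ∀ G H {i j} → injectˡ G H i ≡ injectˡ G H j → i ≡ j
injectˡ-injective (_ ∷ G) H {zero}  {zero}  eq = refl
injectˡ-injective (_ ∷ G) H {suc i} {suc j} eq = cong suc (injectˡ-injective G H (suc-injective eq))

injectʳ-injective : ∀ G H {i j} → injectʳ G H i ≡ injectʳ G H j → i ≡ j
injectʳ-injective []      H eq = eq
injectʳ-injective (_ ∷ G) H eq = injectʳ-injective G H (suc-injective eq)

injectˡ≢injectʳ : ∀ G H i j → injectˡ G H i ≢ injectʳ G H j
injectˡ≢injectʳ (_ ∷ G) H (suc i) j eq = injectˡ≢injectʳ G H i j (suc-injective eq)

data SplitEdge (G H : Graph) : EdgeId (G ++ H) → Set where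
  fromˡ : ∀ i → SplitEdge G H (injectˡ G H i)
  fromʳ : ∀ j → SplitEdge G H (injectʳ G H j)

splitEdge : ∀ G H e → SplitEdge G H e
splitEdge []      H e       = fromʳ e
splitEdge (_ ∷ G) H zero    = fromˡ zero
splitEdge (_ ∷ G) H (suc e) with splitEdge G H e
... | fromˡ i = fromˡ (suc i)
... | fromʳ j = fromʳ j

record _↪ᴱ_ (G G′ : Graph) : Set where
  field
    embed           : EdgeId G → EdgeId G′
    lookup-embed    : ∀ i → lookup G′ (embed i) ≡ lookup G i
    embed-injective : ∀ {i j} → embed i ≡ embed j → i ≡ j
open _↪ᴱ_

++-embedˡ : ∀ G H → G ↪ᴱ (G ++ H)
++-embedˡ G H = record
  { embed = injectˡ G H ; lookup-embed = lookup-injectˡ G H ; embed-injective = injectˡ-injective G H }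

++-embedʳ : ∀ G H → H ↪ᴱ (G ++ H)
++-embedʳ G H = record
  { embed = injectʳ G H ; lookup-embed = lookup-injectʳ G H ; embed-injective = injectʳ-injective G H }

lookup₁∈V : ∀ G i → proj₁ (lookup G i) ∈V G
lookup₁∈V G i = lose (∈-lookup i) (inj₁ refl)

lookup₂∈V : ∀ G i → proj₂ (lookup G i) ∈V G
lookup₂∈V G i = lose (∈-lookup i) (inj₂ refl)

joins∈V : ∀ G i {x y} → Joins (lookup G i) x y → y ∈V G
joins∈V G i (inj₁ (_ , refl)) = lookup₂∈V G i
joins∈V G i (inj₂ (_ , refl)) = lookup₁∈V G i

embedJoins : ∀ {G G′ x y} (E : G ↪ᴱ G′) i → Joins (lookup G i) x y → Joins (lookup G′ (embed E i)) x y
embedJoins {x = x} {y} E i = subst (λ d → Joins d x y) (sym (lookup-embed E i))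

mapWalk : ∀ {G G′ x y} → G ↪ᴱ G′ → Walk G x y → Walk G′ x y
mapWalk E []           = []
mapWalk E (step e j w) = step (embed E e) (embedJoins E e j) (mapWalk E w)

verts-mapWalk : ∀ {G G′ x y} (E : G ↪ᴱ G′) (w : Walk G x y) → verts (mapWalk E w) ≡ verts w
verts-mapWalk E []           = refl
verts-mapWalk E (step e j w) = cong (_ ∷_) (verts-mapWalk E w)

edges-mapWalk : ∀ {G G′ x y} (E : G ↪ᴱ G′) (w : Walk G x y) →
  edges (mapWalk E w) ≡ map (embed E) (edges w)
edges-mapWalk E []           = refl
edges-mapWalk E (step e j w) = cong (_ ∷_) (edges-mapWalk E w)

initVerts : ∀ {G x y} → Walk G x y → List ℕ
initVerts []               = []
initVerts {x = x} (step _ _ w) = x ∷ initVerts w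

verts≡initVerts∷ʳ : ∀ {G x y} (w : Walk G x y) → verts w ≡ initVerts w ∷ʳ y
verts≡initVerts∷ʳ []           = refl
verts≡initVerts∷ʳ (step e j w) = cong (_ ∷_) (verts≡initVerts∷ʳ w)

head∈verts : ∀ {G x y} (w : Walk G x y) → x ∈ verts w
head∈verts []           = here refl
head∈verts (step e j w) = here refl

last∈verts : ∀ {G x y} (w : Walk G x y) → y ∈ verts w
last∈verts []           = here refl
last∈verts (step e j w) = there (last∈verts w)

initVerts⊆verts : ∀ {G x y} (w : Walk G x y) {z} → z ∈ initVerts w → z ∈ verts w
initVerts⊆verts (step e j w) (here refl) = here refl
initVerts⊆verts (step e j w) (there z∈) = there (initVerts⊆verts w z∈)

verts⊆V : ∀ {G x y} → x ∈V G → (w : Walk G x y) → ∀ {z} → z ∈ verts w → z ∈V G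
verts⊆V x∈G []           (here refl) = x∈G
verts⊆V x∈G (step e j w) (here refl) = x∈G
verts⊆V {G} x∈G (step e j w) (there z∈) = verts⊆V (joins∈V G e j) w z∈

initVerts-unique : ∀ {G x y} (w : Walk G x y) → IsPath w → Unique (initVerts w)
initVerts-unique []           _          = []
initVerts-unique (step e j w) (x∉ ∷ uw) =
  All.tabulate (λ z∈ → All.lookup x∉ (initVerts⊆verts w z∈)) ∷ initVerts-unique w uw

last∉initVerts : ∀ {G x y} (w : Walk G x y) → IsPath w → y ∉ initVerts w
last∉initVerts (step e j w) (x∉ ∷ uw) (here refl) = All.lookup x∉ (last∈verts w) refl
last∉initVerts (step e j w) (x∉ ∷ uw) (there y∈) = last∉initVerts w uw y∈

_++ᵂ_ : ∀ {G H u v w} → Walk G u v → Walk H v w → Walk (G ++ H) u w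
_++ᵂ_ {G} {H} []           q = mapWalk (++-embedʳ G H) q
_++ᵂ_ {G} {H} (step e j p) q = step (injectˡ G H e) (embedJoins (++-embedˡ G H) e j) (p ++ᵂ q)

verts-++ᵂ : ∀ {G H u v w} (p : Walk G u v) (q : Walk H v w) → verts (p ++ᵂ q) ≡ initVerts p ++ verts q
verts-++ᵂ {G} {H} []           q = verts-mapWalk (++-embedʳ G H) q
verts-++ᵂ         (step e j p) q = cong (_ ∷_) (verts-++ᵂ p q)

edges-++ᵂ : ∀ {G H u v w} (p : Walk G u v) (q : Walk H v w) →
  edges (p ++ᵂ q) ≡ map (injectˡ G H) (edges p) ++ map (injectʳ G H) (edges q)
edges-++ᵂ {G} {H} []           q = edges-mapWalk (++-embedʳ G H) q
edges-++ᵂ         (step e j p) q = cong (_ ∷_) (edges-++ᵂ p q)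

MeetIn : Graph → Graph → (ℕ → Set) → Set
MeetIn G H P = ∀ {x} → x ∈V G → x ∈V H → P x

meetIn-sym : ∀ {G H P} → MeetIn G H P → MeetIn H G P
meetIn-sym meet x∈H x∈G = meet x∈G x∈H

meetIn-⇔ : ∀ {G H} {P : ℕ → Set} → (∀ x → (x ∈V G × x ∈V H) ⇔ P x) → MeetIn G H P
meetIn-⇔ iso {x} x∈G x∈H = Equivalence.to (iso x) (x∈G , x∈H)

EdgeDisjoint : ∀ {G x y x′ y′} → Walk G x y → Walk G x′ y′ → Set
EdgeDisjoint p q = Disjoint (edges p) (edges q)

map-disjoint : ∀ {A B : Set} {f : A → B} {xs ys} →
  (∀ {i j} → f i ≡ f j → i ≡ j) → Disjoint xs ys → Disjoint (map f xs) (map f ys)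
map-disjoint {f = f} f-inj xs#ys (e∈fxs , e∈fys) with ∈-map⁻ f e∈fxs | ∈-map⁻ f e∈fys
... | i , i∈xs , refl | j , j∈ys , fi≡fj = xs#ys (i∈xs , subst (_∈ _) (sym (f-inj fi≡fj)) j∈ys)

map-disjoint-images : ∀ {A B C : Set} {f : A → C} {g : B → C} {xs ys} →
  (∀ i j → f i ≢ g j) → Disjoint (map f xs) (map g ys)
map-disjoint-images {f = f} {g} f≢g (e∈fxs , e∈gys) with ∈-map⁻ f e∈fxs | ∈-map⁻ g e∈gys
... | i , _ , refl | j , _ , fi≡gj = f≢g i j fi≡gj

++-disjoint : ∀ {A : Set} {xs xs′ ys ys′ : List A} →
  Disjoint xs ys → Disjoint xs ys′ → Disjoint xs′ ys → Disjoint xs′ ys′ →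
  Disjoint (xs ++ xs′) (ys ++ ys′)
++-disjoint {xs = xs} {ys = ys} d₁₁ d₁₂ d₂₁ d₂₂ (v∈xs++xs′ , v∈ys++ys′)
  with ∈-++⁻ xs v∈xs++xs′ | ∈-++⁻ ys v∈ys++ys′
... | inj₁ v∈xs  | inj₁ v∈ys  = d₁₁ (v∈xs , v∈ys)
... | inj₁ v∈xs  | inj₂ v∈ys′ = d₁₂ (v∈xs , v∈ys′)
... | inj₂ v∈xs′ | inj₁ v∈ys  = d₂₁ (v∈xs′ , v∈ys)
... | inj₂ v∈xs′ | inj₂ v∈ys′ = d₂₂ (v∈xs′ , v∈ys′)

mapWalk-edgeDisjoint : ∀ {G G′ x y} (E : G ↪ᴱ G′) (p q : Walk G x y) →
  EdgeDisjoint p q → EdgeDisjoint (mapWalk E p) (mapWalk E q)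
mapWalk-edgeDisjoint E p q p#q =
  subst₂ Disjoint (sym (edges-mapWalk E p)) (sym (edges-mapWalk E q))
    (map-disjoint (embed-injective E) p#q)

++ᵂ-edgeDisjoint : ∀ {G H u v w} (p q : Walk G u v) (p′ q′ : Walk H v w) →
  EdgeDisjoint p q → EdgeDisjoint p′ q′ → EdgeDisjoint (p ++ᵂ p′) (q ++ᵂ q′)
++ᵂ-edgeDisjoint {G} {H} p q p′ q′ p#q p′#q′ =
  subst₂ Disjoint (sym (edges-++ᵂ p p′)) (sym (edges-++ᵂ q q′))
    (++-disjoint (map-disjoint (injectˡ-injective G H) p#q)
                 (map-disjoint-images (injectˡ≢injectʳ G H))
                 (map-disjoint-images (λ j i → injectˡ≢injectʳ G H i j ∘ sym))
                 (map-disjoint (injectʳ-injective G H) p′#q′))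

mapPath : ∀ {G G′ x y} → G ↪ᴱ G′ → Path G x y → Path G′ x y
mapPath E P = mkPath (mapWalk E (walk P)) (subst Unique (sym (verts-mapWalk E (walk P))) (isPath P))

++ᵂ-path : ∀ {G H u v w} → MeetIn G H (_≡ v) → u ∈V G → v ∈V H →
  Path G u v → Path H v w → Path (G ++ H) u w
++ᵂ-path meet u∈G v∈H P Q = mkPath (walk P ++ᵂ walk Q)
  (subst Unique (sym (verts-++ᵂ (walk P) (walk Q)))
    (Unique.++⁺ (initVerts-unique (walk P) (isPath P)) (isPath Q) initP#Q))
  where
  initP#Q : Disjoint (initVerts (walk P)) (verts (walk Q))
  initP#Q (x∈P , x∈Q)
    with meet (verts⊆V u∈G (walk P) (initVerts⊆verts (walk P) x∈P)) (verts⊆V v∈H (walk Q) x∈Q)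
  ... | refl = last∉initVerts (walk P) (isPath P) x∈P

-- Families of internally disjoint bipaths

mapBipath : ∀ {G G′ a b} → G ↪ᴱ G′ → Bipath G a b → Bipath G′ a b
mapBipath E B = mkBipath (mapPath E (P₁ B)) (mapPath E (P₂ B))
  (λ e e∈₁ e∈₂ → mapWalk-edgeDisjoint E (walk (P₁ B)) (walk (P₂ B))
                   (λ (e∈₁ , e∈₂) → edge-disjoint B _ e∈₁ e∈₂) (e∈₁ , e∈₂))
  (subst₂ (λ xs ys → filter (_∈? ys) xs ≡ filter (_∈? xs) ys) (sym vs₁) (sym vs₂) (same-order B))
  (subst₂ (λ xs ys → 3 ≤ length (filter (_∈? ys) xs)) (sym vs₁) (sym vs₂) (three-shared B))
  where
  vs₁ : verts (mapWalk E (walk (P₁ B))) ≡ verts (walk (P₁ B))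
  vs₁ = verts-mapWalk E (walk (P₁ B))
  vs₂ : verts (mapWalk E (walk (P₂ B))) ≡ verts (walk (P₂ B))
  vs₂ = verts-mapWalk E (walk (P₂ B))

∈B-mapBipath : ∀ {G G′ a b} (E : G ↪ᴱ G′) (B : Bipath G a b) {x} → x ∈B mapBipath E B → x ∈B B
∈B-mapBipath E B (inj₁ x∈) = inj₁ (subst (_ ∈_) (verts-mapWalk E (walk (P₁ B))) x∈)
∈B-mapBipath E B (inj₂ x∈) = inj₂ (subst (_ ∈_) (verts-mapWalk E (walk (P₂ B))) x∈)

mapBipath-internallyDisjoint : ∀ {G G′ a b} (E : G ↪ᴱ G′) (B C : Bipath G a b) →
  InternallyDisjoint B C → InternallyDisjoint (mapBipath E B) (mapBipath E C)
mapBipath-internallyDisjoint E B C B#C x x∈B x∈C =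
  B#C x (∈B-mapBipath E B x∈B) (∈B-mapBipath E C x∈C)

∈B⇒∈V : ∀ {G a b} → a ∈V G → (B : Bipath G a b) → ∀ {x} → x ∈B B → x ∈V G
∈B⇒∈V a∈G B (inj₁ x∈) = verts⊆V a∈G (walk (P₁ B)) x∈
∈B⇒∈V a∈G B (inj₂ x∈) = verts⊆V a∈G (walk (P₂ B)) x∈

Pairwise : ∀ {A : Set} → (A → A → Set) → ∀ {k} → (Fin k → A) → Set
Pairwise R B = ∀ i j → i ≢ j → R (B i) (B j)

pairwise-++ : ∀ {A : Set} {R : A → A → Set} {m n} (B : Fin m → A) (C : Fin n → A) →
  (∀ {x y} → R x y → R y x) → Pairwise R B → Pairwise R C → (∀ i j → R (B i) (C j)) →
  Pairwise R (B Vector.++ C)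
pairwise-++ {m = m} B C R-sym RB RC RBC i j i≢j with splitAt m i in split-i | splitAt m j in split-j
... | inj₁ i′ | inj₁ j′ =
  RB i′ j′ λ { refl → i≢j (trans (sym (splitAt⁻¹-↑ˡ split-i)) (splitAt⁻¹-↑ˡ split-j)) }
... | inj₂ i′ | inj₂ j′ =
  RC i′ j′ λ { refl → i≢j (trans (sym (splitAt⁻¹-↑ʳ split-i)) (splitAt⁻¹-↑ʳ split-j)) }
... | inj₁ i′ | inj₂ j′ = RBC i′ j′
... | inj₂ i′ | inj₁ j′ = R-sym (RBC j′ i′)

internallyDisjoint-sym : ∀ {G a b} {B C : Bipath G a b} → InternallyDisjoint B C → InternallyDisjoint C B
internallyDisjoint-sym B#C x x∈C x∈B = B#C x x∈B x∈C

DisjointBipaths : Graph → ℕ → ℕ → ℕ → Set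
DisjointBipaths G a b k = Σ (Fin k → Bipath G a b) (Pairwise InternallyDisjoint)

[_] : ∀ {G a b} → Bipath G a b → DisjointBipaths G a b 1
[ B ] = (λ _ → B) , λ { zero zero 0≢0 → ⊥-elim (0≢0 refl) }

mapDisjointBipaths : ∀ {G G′ a b k} → G ↪ᴱ G′ → DisjointBipaths G a b k → DisjointBipaths G′ a b k
mapDisjointBipaths E (B , B-disjoint) =
  (λ i → mapBipath E (B i)) ,
  λ i j i≢j → mapBipath-internallyDisjoint E (B i) (B j) (B-disjoint i j i≢j)

disjointBipaths-parallel : ∀ {G H u v k₁ k₂} → MeetIn G H (λ x → x ≡ u ⊎ x ≡ v) → u ∈V G → u ∈V H →
  DisjointBipaths G u v k₁ → DisjointBipaths H u v k₂ → DisjointBipaths (G ++ H) u v (k₁ + k₂)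
disjointBipaths-parallel {G} {H} {u} {v} {k₁} {k₂} meet u∈G u∈H (B , B#) (C , C#) =
  proj₁ Bˡ Vector.++ proj₁ Cʳ ,
  pairwise-++ (proj₁ Bˡ) (proj₁ Cʳ) (λ {X Y} → internallyDisjoint-sym {B = X} {Y}) (proj₂ Bˡ) (proj₂ Cʳ) across
  where
  Bˡ : DisjointBipaths (G ++ H) u v k₁
  Bˡ = mapDisjointBipaths (++-embedˡ G H) (B , B#)
  Cʳ : DisjointBipaths (G ++ H) u v k₂
  Cʳ = mapDisjointBipaths (++-embedʳ G H) (C , C#)
  across : ∀ i j → InternallyDisjoint (proj₁ Bˡ i) (proj₁ Cʳ j)
  across i j x x∈B x∈C =
    meet (∈B⇒∈V u∈G (B i) (∈B-mapBipath (++-embedˡ G H) (B i) x∈B))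
         (∈B⇒∈V u∈H (C j) (∈B-mapBipath (++-embedʳ G H) (C j) x∈C))

source∈V : ∀ {G u v} → GSP G u v → u ∈V G
source∈V (single u v _)  = here (inj₁ refl)
source∈V (ser t₁ t₂ _)   = ++⁺ˡ (source∈V t₁)
source∈V (par t₁ t₂ _)   = ++⁺ˡ (source∈V t₁)
source∈V (brL t₁ t₂ _)   = ++⁺ˡ (source∈V t₁)
source∈V (brR t₁ t₂ _)   = ++⁺ˡ (source∈V t₁)

target∈V : ∀ {G u v} → GSP G u v → v ∈V G
target∈V (single u v _)    = here (inj₂ refl)
target∈V (ser {G} t₁ t₂ _) = ++⁺ʳ G (target∈V t₂)
target∈V (par t₁ t₂ _)     = ++⁺ˡ (target∈V t₁)
target∈V (brL t₁ t₂ _)     = ++⁺ˡ (target∈V t₁)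
target∈V (brR t₁ t₂ _)     = ++⁺ˡ (target∈V t₁)

terminals-distinct : ∀ {G u v} → GSP G u v → u ≢ v
terminals-distinct (single u v u≢v) = u≢v
terminals-distinct (ser t₁ t₂ iso) refl =
  terminals-distinct t₁ (meetIn-⇔ iso (source∈V t₁) (target∈V t₂))
terminals-distinct (par t₁ t₂ _) = terminals-distinct t₁
terminals-distinct (brL t₁ t₂ _) = terminals-distinct t₁
terminals-distinct (brR t₁ t₂ _) = terminals-distinct t₁

gsp-path : ∀ {G u v} → GSP G u v → Path G u v
gsp-path (single u v u≢v) = mkPath (step zero (inj₁ (refl , refl)) []) ((u≢v ∷ []) ∷ [] ∷ [])
gsp-path (ser t₁ t₂ iso) =
  ++ᵂ-path (meetIn-⇔ iso) (source∈V t₁) (source∈V t₂) (gsp-path t₁) (gsp-path t₂)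
gsp-path (par {G} {H} t₁ t₂ _) = mapPath (++-embedˡ G H) (gsp-path t₁)
gsp-path (brL {G} {H} t₁ t₂ _) = mapPath (++-embedˡ G H) (gsp-path t₁)
gsp-path (brR {G} {H} t₁ t₂ _) = mapPath (++-embedˡ G H) (gsp-path t₁)

-- Cuts

Balanced : (ℕ → Bool) → Edge → Set
Balanced side d = side (proj₁ d) ≡ side (proj₂ d)

record Separation (G : Graph) : Set where
  constructor separation
  field
    bridge   : EdgeId G
    side     : ℕ → Bool
    balanced : ∀ i → i ≢ bridge → Balanced side (lookup G i)
open Separation

Cut : Graph → ℕ → ℕ → Set
Cut G u v = Σ (Separation G) λ S → side S u ≡ true × side S v ≡ false

joins-balanced : ∀ side d {x y} → Joins d x y → Balanced side d → side x ≡ side y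
joins-balanced side d (inj₁ (refl , refl)) eq = eq
joins-balanced side d (inj₂ (refl , refl)) eq = sym eq

bridge∈walk : ∀ {G} (S : Separation G) {x y} → side S x ≡ true → side S y ≡ false →
  (w : Walk G x y) → bridge S ∈ edges w
bridge∈walk S sx sy [] with () ← trans (sym sx) sy
bridge∈walk {G} S sx sy (step {y = z} e j w) with side S z in sz
... | true = there (bridge∈walk S sz sy w)
... | false with e ≟ᶠ bridge S
...   | yes refl = here refl
...   | no e≢bridge
  with () ← trans (sym sx) (trans (joins-balanced (side S) (lookup G e) j (balanced S e e≢bridge)) sz)

cut⇒bridged : ∀ {G u v} → Cut G u v → Bridged G u v
cut⇒bridged (S , su , sv) = bridge S , λ P → bridge∈walk S su sv (walk P)

_∈V?_ : ∀ x G → Dec (x ∈V G)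
x ∈V? G = any? (λ e → (x ≟ proj₁ e) ⊎-dec (x ≟ proj₂ e)) G

extendSide : (ℕ → Bool) → Graph → ℕ → ℕ → Bool
extendSide side H c x = if does (x ∈V? H) then side c else side x

extendSide-agrees : ∀ side {G H c x} → MeetIn G H (_≡ c) → x ∈V G → extendSide side H c x ≡ side x
extendSide-agrees side {H = H} {x = x} meet x∈G with x ∈V? H
... | yes x∈H = cong side (sym (meet x∈G x∈H))
... | no _    = refl

extendSide-const : ∀ side {H c x} → x ∈V H → extendSide side H c x ≡ side c
extendSide-const side {H} {x = x} x∈H with x ∈V? H
... | yes _   = refl
... | no x∉H = ⊥-elim (x∉H x∈H)

balanced-++ : ∀ G H side (e : EdgeId (G ++ H)) →
  (∀ i → injectˡ G H i ≢ e → Balanced side (lookup G i)) →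
  (∀ j → injectʳ G H j ≢ e → Balanced side (lookup H j)) →
  ∀ i → i ≢ e → Balanced side (lookup (G ++ H) i)
balanced-++ G H side e balancedˡ balancedʳ i i≢e with splitEdge G H i
... | fromˡ i′ rewrite lookup-injectˡ G H i′ = balancedˡ i′ i≢e
... | fromʳ j′ rewrite lookup-injectʳ G H j′ = balancedʳ j′ i≢e

extendSide-balanced : ∀ side {G H c} → MeetIn G H (_≡ c) → ∀ i →
  Balanced side (lookup G i) → Balanced (extendSide side H c) (lookup G i)
extendSide-balanced side {G} meet i eq =
  trans (extendSide-agrees side meet (lookup₁∈V G i))
    (trans eq (sym (extendSide-agrees side meet (lookup₂∈V G i))))

extendSide-balanced-glued : ∀ side {H} c j → Balanced (extendSide side H c) (lookup H j)
extendSide-balanced-glued side {H} c j =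
  trans (extendSide-const side (lookup₁∈V H j)) (sym (extendSide-const side (lookup₂∈V H j)))

separation-++ʳ : ∀ {G H c} → MeetIn G H (_≡ c) → Separation G → Separation (G ++ H)
separation-++ʳ {G} {H} {c} meet (separation e side bal) =
  separation (injectˡ G H e) (extendSide side H c)
    (balanced-++ G H (extendSide side H c) (injectˡ G H e)
      (λ i i≢e → extendSide-balanced side meet i (bal i λ { refl → i≢e refl }))
      (λ j _ → extendSide-balanced-glued side {H} c j))

separation-++ˡ : ∀ {G H c} → MeetIn H G (_≡ c) → Separation H → Separation (G ++ H)
separation-++ˡ {G} {H} {c} meet (separation e side bal) =
  separation (injectʳ G H e) (extendSide side G c)
    (balanced-++ G H (extendSide side G c) (injectʳ G H e)
      (λ i _ → extendSide-balanced-glued side {G} c i)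
      (λ j j≢e → extendSide-balanced side meet j (bal j λ { refl → j≢e refl })))

cut-single : ∀ u v → u ≢ v → Cut ((u , v) ∷ []) u v
cut-single u v u≢v =
  separation zero (λ x → does (x ≟ u)) (λ { zero 0≢0 → ⊥-elim (0≢0 refl) }) ,
  dec-true (u ≟ u) refl , dec-false (v ≟ u) (u≢v ∘ sym)

cut-++ʳ : ∀ {G H u v c} → MeetIn G H (_≡ c) → u ∈V G → v ∈V G → Cut G u v → Cut (G ++ H) u v
cut-++ʳ meet u∈G v∈G (S , su , sv) =
  separation-++ʳ meet S ,
  trans (extendSide-agrees (side S) meet u∈G) su , trans (extendSide-agrees (side S) meet v∈G) sv

cut-series-left : ∀ {G H u v w} → MeetIn G H (_≡ v) → u ∈V G → w ∈V H → Cut G u v → Cut (G ++ H) u w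
cut-series-left meet u∈G w∈H (S , su , sv) =
  separation-++ʳ meet S ,
  trans (extendSide-agrees (side S) meet u∈G) su , trans (extendSide-const (side S) w∈H) sv

cut-series-right : ∀ {G H u v w} → MeetIn G H (_≡ v) → u ∈V G → w ∈V H → Cut H v w → Cut (G ++ H) u w
cut-series-right meet u∈G w∈H (S , sv , sw) =
  separation-++ˡ (meetIn-sym meet) S ,
  trans (extendSide-const (side S) u∈G) sv , trans (extendSide-agrees (side S) (meetIn-sym meet) w∈H) sw

-- Pairs of paths with the same common vertices in the same order

_∩_ : List ℕ → List ℕ → List ℕ
xs ∩ ys = filter (_∈? ys) xs

∩-cong : ∀ xs {ys zs} → (∀ {x} → x ∈ xs → x ∈ ys ⇔ x ∈ zs) → xs ∩ ys ≡ xs ∩ zs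
∩-cong []       eqv = refl
∩-cong (x ∷ xs) {ys} {zs} eqv with x ∈? ys | x ∈? zs
... | yes _    | yes _    = cong (x ∷_) (∩-cong xs (eqv ∘ there))
... | yes x∈ys | no x∉zs = ⊥-elim (x∉zs (Equivalence.to (eqv (here refl)) x∈ys))
... | no x∉ys  | yes x∈zs = ⊥-elim (x∉ys (Equivalence.from (eqv (here refl)) x∈zs))
... | no _     | no _     = ∩-cong xs (eqv ∘ there)

∩-∷ʳ : ∀ xs {y ys} → y ∈ ys → (xs ∷ʳ y) ∩ ys ≡ (xs ∩ ys) ∷ʳ y
∩-∷ʳ xs {ys = ys} y∈ys =
  trans (filter-++ (_∈? ys) xs _) (cong (xs ∩ ys ++_) (filter-accept (_∈? ys) y∈ys))

record PathPair (G : Graph) (u v : ℕ) : Set where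
  field
    path₁ path₂ : Path G u v
    disjoint    : EdgeDisjoint (walk path₁) (walk path₂)
    inner       : List ℕ
    common₁     : verts (walk path₁) ∩ verts (walk path₂) ≡ u ∷ inner ∷ʳ v
    common₂     : verts (walk path₂) ∩ verts (walk path₁) ≡ u ∷ inner ∷ʳ v
open PathPair

pathPair⇒bipath : ∀ {G u v} (P : PathPair G u v) → 1 ≤ length (inner P) → Bipath G u v
pathPair⇒bipath {u = u} {v} P 1≤inner =
  mkBipath (path₁ P) (path₂ P) (λ e e∈₁ e∈₂ → disjoint P (e∈₁ , e∈₂))
    (trans (common₁ P) (sym (common₂ P)))
    (subst (λ xs → 3 ≤ length xs) (sym (common₁ P))
      (s≤s (subst (2 ≤_) (sym (length-++ (inner P))) (+-monoˡ-≤ 1 1≤inner))))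

mapPathPair : ∀ {G G′ u v} → G ↪ᴱ G′ → PathPair G u v → PathPair G′ u v
mapPathPair E P = record
  { path₁ = mapPath E (path₁ P) ; path₂ = mapPath E (path₂ P)
  ; disjoint = mapWalk-edgeDisjoint E (walk (path₁ P)) (walk (path₂ P)) (disjoint P)
  ; inner = inner P
  ; common₁ = subst₂ (λ xs ys → xs ∩ ys ≡ _) (sym vs₁) (sym vs₂) (common₁ P)
  ; common₂ = subst₂ (λ xs ys → ys ∩ xs ≡ _) (sym vs₁) (sym vs₂) (common₂ P) }
  where
  vs₁ : verts (mapWalk E (walk (path₁ P))) ≡ verts (walk (path₁ P))
  vs₁ = verts-mapWalk E (walk (path₁ P))
  vs₂ : verts (mapWalk E (walk (path₂ P))) ≡ verts (walk (path₂ P))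
  vs₂ = verts-mapWalk E (walk (path₂ P))

common-parallel : ∀ {G H u v} → MeetIn G H (λ x → x ≡ u ⊎ x ≡ v) → u ≢ v → u ∈V G → u ∈V H →
  (p : Walk G u v) (q : Walk H u v) → IsPath p → verts p ∩ verts q ≡ u ∷ v ∷ []
common-parallel meet u≢v u∈G u∈H [] q _ = ⊥-elim (u≢v refl)
common-parallel {u = u} {v} meet u≢v u∈G u∈H (step e j p) q (u∉p ∷ p-path) =
  begin
    (u ∷ verts p) ∩ verts q
  ≡⟨ filter-accept (_∈? verts q) (head∈verts q) ⟩
    u ∷ verts p ∩ verts q
  ≡⟨ cong (λ xs → u ∷ xs ∩ verts q) (verts≡initVerts∷ʳ p) ⟩
    u ∷ (initVerts p ∷ʳ v) ∩ verts q
  ≡⟨ cong (u ∷_) (∩-∷ʳ (initVerts p) (last∈verts q)) ⟩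
    u ∷ (initVerts p ∩ verts q) ∷ʳ v
  ≡⟨ cong (λ xs → u ∷ xs ∷ʳ v) (filter-none (_∈? verts q) (All.tabulate interior∉q)) ⟩
    u ∷ v ∷ []
  ∎
  where
  open ≡-Reasoning
  interior∉q : ∀ {x} → x ∈ initVerts p → x ∉ verts q
  interior∉q x∈p x∈q
    with meet (verts⊆V u∈G (step e j p) (there (initVerts⊆verts p x∈p))) (verts⊆V u∈H q x∈q)
  ... | inj₁ refl = All.lookup u∉p (initVerts⊆verts p x∈p) refl
  ... | inj₂ refl = last∉initVerts p p-path x∈p

pathPair-parallel : ∀ {G H u v} → MeetIn G H (λ x → x ≡ u ⊎ x ≡ v) → u ≢ v → u ∈V G → u ∈V H →
  Path G u v → Path H u v → PathPair (G ++ H) u v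
pathPair-parallel {G} {H} meet u≢v u∈G u∈H P Q = record
  { path₁ = mapPath (++-embedˡ G H) P ; path₂ = mapPath (++-embedʳ G H) Q
  ; disjoint = subst₂ Disjoint (sym (edges-mapWalk (++-embedˡ G H) (walk P)))
                 (sym (edges-mapWalk (++-embedʳ G H) (walk Q)))
                 (map-disjoint-images (injectˡ≢injectʳ G H))
  ; inner = []
  ; common₁ = subst₂ (λ xs ys → xs ∩ ys ≡ _) (sym vsP) (sym vsQ)
                (common-parallel meet u≢v u∈G u∈H (walk P) (walk Q) (isPath P))
  ; common₂ = subst₂ (λ xs ys → ys ∩ xs ≡ _) (sym vsP) (sym vsQ)
                (common-parallel (meetIn-sym meet) u≢v u∈H u∈G (walk Q) (walk P) (isPath Q)) }
  where
  vsP : verts (mapWalk (++-embedˡ G H) (walk P)) ≡ verts (walk P)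
  vsP = verts-mapWalk (++-embedˡ G H) (walk P)
  vsQ : verts (mapWalk (++-embedʳ G H) (walk Q)) ≡ verts (walk Q)
  vsQ = verts-mapWalk (++-embedʳ G H) (walk Q)

common-series : ∀ {G H u v w} → MeetIn G H (_≡ v) → u ∈V G → v ∈V H →
  (p q : Walk G u v) (p′ q′ : Walk H v w) → IsPath p → ∀ M M′ →
  verts p ∩ verts q ≡ u ∷ M ∷ʳ v → verts p′ ∩ verts q′ ≡ v ∷ M′ ∷ʳ w →
  (initVerts p ++ verts p′) ∩ (initVerts q ++ verts q′) ≡ u ∷ (M ++ v ∷ M′) ∷ʳ w
common-series {G} {H} {u} {v} {w} meet u∈G v∈H p q p′ q′ p-path M M′ pq p′q′ =
  begin
    (initVerts p ++ verts p′) ∩ (initVerts q ++ verts q′)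
  ≡⟨ filter-++ (_∈? (initVerts q ++ verts q′)) (initVerts p) (verts p′) ⟩
    initVerts p ∩ (initVerts q ++ verts q′) ++ verts p′ ∩ (initVerts q ++ verts q′)
  ≡⟨ cong₂ _++_ (∩-cong (initVerts p) (λ x∈p → mk⇔ (to-q x∈p) (from-q x∈p)))
                (∩-cong (verts p′) (λ x∈p′ → mk⇔ (to-q′ x∈p′) (∈-++⁺ʳ (initVerts q)))) ⟩
    initVerts p ∩ verts q ++ verts p′ ∩ verts q′
  ≡⟨ cong₂ _++_ initp∩q p′q′ ⟩
    (u ∷ M) ++ v ∷ M′ ∷ʳ w
  ≡⟨ cong (u ∷_) (sym (++-assoc M (v ∷ M′) (w ∷ []))) ⟩
    u ∷ (M ++ v ∷ M′) ∷ʳ w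
  ∎
  where
  open ≡-Reasoning
  v∉initp : v ∉ initVerts p
  v∉initp = last∉initVerts p p-path
  in-G : ∀ {x} → x ∈ initVerts p → x ∈V G
  in-G x∈p = verts⊆V u∈G p (initVerts⊆verts p x∈p)
  to-q : ∀ {x} → x ∈ initVerts p → x ∈ initVerts q ++ verts q′ → x ∈ verts q
  to-q x∈p x∈ with ∈-++⁻ (initVerts q) x∈
  ... | inj₁ x∈q  = initVerts⊆verts q x∈q
  ... | inj₂ x∈q′ with meet (in-G x∈p) (verts⊆V v∈H q′ x∈q′)
  ...   | refl = ⊥-elim (v∉initp x∈p)
  from-q : ∀ {x} → x ∈ initVerts p → x ∈ verts q → x ∈ initVerts q ++ verts q′
  from-q x∈p x∈q with ∈-++⁻ (initVerts q) (subst (_ ∈_) (verts≡initVerts∷ʳ q) x∈q)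
  ... | inj₁ x∈initq = ∈-++⁺ˡ x∈initq
  ... | inj₂ (here refl) = ⊥-elim (v∉initp x∈p)
  to-q′ : ∀ {x} → x ∈ verts p′ → x ∈ initVerts q ++ verts q′ → x ∈ verts q′
  to-q′ x∈p′ x∈ with ∈-++⁻ (initVerts q) x∈
  ... | inj₂ x∈q′ = x∈q′
  ... | inj₁ x∈q with meet (verts⊆V u∈G q (initVerts⊆verts q x∈q)) (verts⊆V v∈H p′ x∈p′)
  ...   | refl = head∈verts q′
  initp∩q : initVerts p ∩ verts q ≡ u ∷ M
  initp∩q = ∷ʳ-injectiveˡ (initVerts p ∩ verts q) (u ∷ M)
    (trans (sym (∩-∷ʳ (initVerts p) (last∈verts q)))
      (trans (cong (_∩ verts q) (sym (verts≡initVerts∷ʳ p))) pq))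

pathPair-series : ∀ {G H u v w} → MeetIn G H (_≡ v) → u ∈V G → v ∈V H →
  (P : PathPair G u v) (Q : PathPair H v w) → PathPair (G ++ H) u w
pathPair-series {G} {H} {u} {v} {w} meet u∈G v∈H P Q = record
  { path₁ = ++ᵂ-path meet u∈G v∈H (path₁ P) (path₁ Q)
  ; path₂ = ++ᵂ-path meet u∈G v∈H (path₂ P) (path₂ Q)
  ; disjoint = ++ᵂ-edgeDisjoint p₁ p₂ q₁ q₂ (disjoint P) (disjoint Q)
  ; inner = inner P ++ _ ∷ inner Q
  ; common₁ = subst₂ (λ xs ys → xs ∩ ys ≡ _) (sym vs₁) (sym vs₂)
      (common-series meet u∈G v∈H p₁ p₂ q₁ q₂ (isPath (path₁ P)) _ _ (common₁ P) (common₁ Q))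
  ; common₂ = subst₂ (λ xs ys → ys ∩ xs ≡ _) (sym vs₁) (sym vs₂)
      (common-series meet u∈G v∈H p₂ p₁ q₂ q₁ (isPath (path₂ P)) _ _ (common₂ P) (common₂ Q)) }
  where
  p₁ p₂ : Walk G u v
  p₁ = walk (path₁ P)
  p₂ = walk (path₂ P)
  q₁ q₂ : Walk H v w
  q₁ = walk (path₁ Q)
  q₂ = walk (path₂ Q)
  vs₁ : verts (p₁ ++ᵂ q₁) ≡ initVerts p₁ ++ verts q₁
  vs₁ = verts-++ᵂ p₁ q₁
  vs₂ : verts (p₂ ++ᵂ q₂) ≡ initVerts p₂ ++ verts q₂
  vs₂ = verts-++ᵂ p₂ q₂

1≤length-++-∷ : ∀ (xs : List ℕ) x ys → 1 ≤ length (xs ++ x ∷ ys)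
1≤length-++-∷ xs x ys = ≤-trans (s≤s z≤n) (length-++-≤ʳ (x ∷ ys) {xs})

-- The dichotomy and the theorem

series-cut-or-pathPair : ∀ {G H u v w} → MeetIn G H (_≡ v) → u ∈V G → v ∈V H → w ∈V H →
  Cut G u v ⊎ PathPair G u v → Cut H v w ⊎ PathPair H v w →
  Cut (G ++ H) u w ⊎ Σ (PathPair (G ++ H) u w) λ P → 1 ≤ length (inner P)
series-cut-or-pathPair meet u∈G v∈H w∈H (inj₁ C) _        = inj₁ (cut-series-left meet u∈G w∈H C)
series-cut-or-pathPair meet u∈G v∈H w∈H (inj₂ _) (inj₁ C) = inj₁ (cut-series-right meet u∈G w∈H C)
series-cut-or-pathPair meet u∈G v∈H w∈H (inj₂ P) (inj₂ Q) =
  inj₂ (pathPair-series meet u∈G v∈H P Q , 1≤length-++-∷ (inner P) _ (inner Q))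

cut-or-pathPair : ∀ {G u v} → GSP G u v → Cut G u v ⊎ PathPair G u v

cut-or-pathPair-series : ∀ {G H u v w} → GSP G u v → GSP H v w → (∀ x → (x ∈V G × x ∈V H) ⇔ (x ≡ v)) →
  Cut (G ++ H) u w ⊎ Σ (PathPair (G ++ H) u w) λ P → 1 ≤ length (inner P)
cut-or-pathPair-series t₁ t₂ iso =
  series-cut-or-pathPair (meetIn-⇔ iso) (source∈V t₁) (source∈V t₂) (target∈V t₂)
    (cut-or-pathPair t₁) (cut-or-pathPair t₂)

cut-or-pathPair (single u v u≢v) = inj₁ (cut-single u v u≢v)
cut-or-pathPair (ser t₁ t₂ iso) = Sum.map₂ proj₁ (cut-or-pathPair-series t₁ t₂ iso)
cut-or-pathPair (par t₁ t₂ iso) =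
  inj₂ (pathPair-parallel (meetIn-⇔ iso) (terminals-distinct t₁) (source∈V t₁) (source∈V t₂)
          (gsp-path t₁) (gsp-path t₂))
cut-or-pathPair (brL {G} {H} t₁ t₂ iso) with cut-or-pathPair t₁
... | inj₁ C = inj₁ (cut-++ʳ (meetIn-⇔ iso) (source∈V t₁) (target∈V t₁) C)
... | inj₂ P = inj₂ (mapPathPair (++-embedˡ G H) P)
cut-or-pathPair (brR {G} {H} t₁ t₂ iso) with cut-or-pathPair t₁
... | inj₁ C = inj₁ (cut-++ʳ (meetIn-⇔ iso) (source∈V t₁) (target∈V t₁) C)
... | inj₂ P = inj₂ (mapPathPair (++-embedˡ G H) P)

disjointBipaths : ∀ {G a b} {T : GSP G a b} {k} → Complexity T k → DisjointBipaths G a b k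
disjointBipaths (single-br _) = (λ ()) , λ ()
disjointBipaths (single-nbr {u} {v} {u≢v} not-bridged) =
  ⊥-elim (not-bridged (cut⇒bridged (cut-single u v u≢v)))
disjointBipaths (ser-br _) = (λ ()) , λ ()
disjointBipaths (ser-nbr {t₁ = t₁} {t₂} {iso} not-bridged) with cut-or-pathPair-series t₁ t₂ iso
... | inj₁ C              = ⊥-elim (not-bridged (cut⇒bridged C))
... | inj₂ (P , 1≤inner) = [ pathPair⇒bipath P 1≤inner ]
disjointBipaths (par-c {t₁ = t₁} {t₂} {iso} c₁ c₂) =
  disjointBipaths-parallel (meetIn-⇔ iso) (source∈V t₁) (source∈V t₂)
    (disjointBipaths c₁) (disjointBipaths c₂)
disjointBipaths (brL-c {G} {H} c) = mapDisjointBipaths (++-embedˡ G H) (disjointBipaths c)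
disjointBipaths (brR-c {G} {H} c) = mapDisjointBipaths (++-embedˡ G H) (disjointBipaths c)

lemma8p6 : (G : Graph) (a b : ℕ) (T : GSP G a b) (k : ℕ) → Complexity T k →
    Σ (Fin k → Bipath G a b) λ B → ∀ i j → i ≢ j → InternallyDisjoint (B i) (B j)
lemma8p6 G a b T k c = disjointBipaths c
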